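{- Let $T$ be a tournament and let $\sigma$ be any ordering of $V(T)$ in which the vertices appear in non-decreasing order of in-degree (ties broken arbitrarily). Then $\Delta_\sigma(T)\leq 3\Delta(T)$. Moreover, the factor $3$ is tight: there exists a tournament $T$ and such an ordering $\sigma$ with $\Delta_\sigma(T)=3\Delta(T)>0$.
   Context: A tournament is a digraph with exactly one arc between each pair of distinct vertices. Given an ordering $\sigma = \langle v_1,\dots,v_n\rangle$ of $V(T)$, an arc $(v_i,v_j)$ is backward if $j<i$. For a vertex $v$, $d_\sigma(v)$ is the number of backward arcs of $\sigma$ incident to $v$; $\Delta_\sigma(T)=\max_{v} d_\sigma(v)$; the degreewidth of $T$ is $\Delta(T)=\min_\sigma \Delta_\sigma(T)$ over all orderings $\sigma$ of $V(T)$. -}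

module Defs where

open import Data.Nat using (ℕ; _≤_; _<_; _⊔_; zero; suc)
open import Data.Bool using (Bool; true; false; not; _∧_; _∨_)
open import Data.Fin using (Fin) renaming (_<_ to _<ᶠ_; _≤_ to _≤ᶠ_)
open import Data.Fin.Properties using (_<?_)
open import Data.Fin.Permutation using (Permutation′; _⟨$⟩ʳ_; _⟨$⟩ˡ_)
open import Data.List using (List; length; filterᵇ; allFin; map; foldr)
open import Relation.Binary.PropositionalEquality using (_≡_; _≢_)
open import Relation.Nullary.Decidable using (⌊_⌋)
open import Data.Product using (Σ; _×_)

record Tournament (n : ℕ) : Set where
  field
    arc     : Fin n → Fin n → Bool
    irrefl  : ∀ v → arc v v ≡ false
    tourn   : ∀ u v → u ≢ v → arc u v ≡ not (arc v u)
open Tournament public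

-- An ordering of V(T): σ ⟨$⟩ʳ i is the vertex at position i (i.e. v_{i}).
Ordering : ℕ → Set
Ordering n = Permutation′ n

pos : ∀ {n} → Ordering n → Fin n → Fin n
pos σ v = σ ⟨$⟩ˡ v

count : ∀ {n} → (Fin n → Bool) → ℕ
count {n} p = length (filterᵇ p (allFin n))

inDeg : ∀ {n} → Tournament n → Fin n → ℕ
inDeg T v = count (λ u → arc T u v)

backward : ∀ {n} → Tournament n → Ordering n → Fin n → Fin n → Bool
backward T σ u w = arc T u w ∧ ⌊ pos σ w <? pos σ u ⌋

dσ : ∀ {n} → Tournament n → Ordering n → Fin n → ℕ
dσ T σ v = count (λ w → backward T σ v w ∨ backward T σ w v)

-- Δ_σ(T) = max_v d_σ(v)  (0 for the empty tournament)
Δσ : ∀ {n} → Tournament n → Ordering n → ℕ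
Δσ {n} T σ = foldr _⊔_ 0 (map (dσ T σ) (allFin n))

IsDegreewidth : ∀ {n} → Tournament n → ℕ → Set
IsDegreewidth {n} T k =
  Σ (Ordering n) (λ σ → Δσ T σ ≡ k) × (∀ (σ : Ordering n) → k ≤ Δσ T σ)

InDegreeSorted : ∀ {n} → Tournament n → Ordering n → Set
InDegreeSorted {n} T σ =
  ∀ (i j : Fin n) → i ≤ᶠ j → inDeg T (σ ⟨$⟩ʳ i) ≤ inDeg T (σ ⟨$⟩ʳ j)

-- Let s be an ordering with Δ_s(T) = k. Splitting the vertices preceding v in s into
-- in- and out-neighbours of v gives  inDeg v + out_s(v) = pos_s(v) + in_s(v), where
-- out_s/in_s count the backward arcs of s leaving/entering v; hence pos_s and inDeg
-- differ by at most k everywhere. A backward arc of σ at v is backward in s (at most k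
-- such arcs) or joins v to some w lying on the other side of v in s. For an out-arc
-- v → w of the second kind, sortedness of σ gives inDeg w ≤ inDeg v, so pos_s(w) lies
-- in the window (pos_s(v), pos_s(v) + in_s(v) + k − out_s(v)]; symmetrically for in-arcs.
-- The two window lengths add up to 2k, so d_σ(v) ≤ 3k.
-- Tightness: a 5-vertex tournament containing a directed triangle has degreewidth 1 but
-- admits an in-degree-sorted ordering with Δ_σ = 3.
module Submission where

open import Defs
open import Data.Nat using (ℕ; zero; suc; _+_; _*_; _∸_; _⊔_; _≤_; _<_; z≤n; s≤s; s≤s⁻¹; s<s; s<s⁻¹)
open import Data.Nat.Properties hiding (_<?_; _≟_)
open import Data.Nat.Tactic.RingSolver using (solve)
open import Data.Bool using (Bool; true; false; T; not; _∧_; _∨_)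
open import Data.Bool.Properties using (not-involutive; ∧-comm; T-∧; T-∨; T-≡) renaming (_≟_ to _≟ᵇ_)
open import Data.Fin using (Fin; toℕ; zero; suc; _≟_)
open import Data.Fin.Patterns
open import Data.Fin.Properties using (_<?_; toℕ-injective; all?) renaming (_≤?_ to _≤ᶠ?_)
open import Data.Fin.Permutation
  using (Permutation′; _⟨$⟩ʳ_; inverseˡ; inverseʳ; transpose; _∘ₚ_) renaming (id to idₚ)
open import Data.List using (List; []; _∷_; length; filterᵇ; tabulate; map; foldr; allFin)
open import Data.List.Membership.Propositional using (_∈_)
open import Data.List.Membership.Propositional.Properties using (∈-allFin)
open import Data.List.Relation.Unary.Any using (here; there)
open import Data.Product as Product using (Σ; _×_; _,_; proj₁; proj₂)
open import Data.Sum using (_⊎_; inj₁; inj₂)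
open import Data.Empty using (⊥-elim)
open import Data.Vec.Functional using (removeAt)
open import Function using (_∘_; Equivalence)
open import Relation.Binary.PropositionalEquality
open import Relation.Nullary using (¬_; yes; no; contradiction)
open import Relation.Nullary.Decidable using (⌊_⌋; toWitness; fromWitness; ¬?; _→-dec_)
open import Algebra.Properties.CommutativeSemigroup +-commutativeSemigroup using (xy∙z≈xz∙y)
open import Algebra.Properties.CommutativeMonoid.Sum +-0-commutativeMonoid
  using (sum; sum-cong-≗; ∑-distrib-+; sum-permute; sum-remove)

boolToℕ : Bool → ℕ
boolToℕ false = 0
boolToℕ true  = 1

boolToℕ-mono : ∀ {a b} → (T a → T b) → boolToℕ a ≤ boolToℕ b
boolToℕ-mono {false}         _   = z≤n
boolToℕ-mono {true}  {true}  _   = ≤-refl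
boolToℕ-mono {true}  {false} a⇒b = ⊥-elim (a⇒b _)

boolToℕ-cover : ∀ {a b c} → (T a → T b ⊎ T c) → boolToℕ a ≤ boolToℕ b + boolToℕ c
boolToℕ-cover {false}                 _ = z≤n
boolToℕ-cover {true}  {true}          _ = s≤s z≤n
boolToℕ-cover {true}  {false} {true}  _ = s≤s z≤n
boolToℕ-cover {true}  {false} {false} a⇒b∨c with a⇒b∨c _
... | inj₁ ()
... | inj₂ ()

boolToℕ-split : ∀ a b → boolToℕ a ≡ boolToℕ (a ∧ b) + boolToℕ (a ∧ not b)
boolToℕ-split false _     = refl
boolToℕ-split true  true  = refl
boolToℕ-split true  false = refl

boolToℕ≤1 : ∀ b → boolToℕ b ≤ 1
boolToℕ≤1 false = z≤n
boolToℕ≤1 true  = s≤s z≤n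

T⇒0<boolToℕ : ∀ {b} → T b → 0 < boolToℕ b
T⇒0<boolToℕ {true} _ = s≤s z≤n

¬T⇒boolToℕ≡0 : ∀ {b} → ¬ T b → boolToℕ b ≡ 0
¬T⇒boolToℕ≡0 {false} _  = refl
¬T⇒boolToℕ≡0 {true}  ¬b = ⊥-elim (¬b _)

sum-mono-≤ : ∀ {n} {f g : Fin n → ℕ} → (∀ i → f i ≤ g i) → sum f ≤ sum g
sum-mono-≤ {zero}  f≤g = z≤n
sum-mono-≤ {suc n} f≤g = +-mono-≤ (f≤g zero) (sum-mono-≤ (f≤g ∘ suc))

length-filterᵇ-tabulate : ∀ {n} {A : Set} (p : A → Bool) (f : Fin n → A) →
  length (filterᵇ p (tabulate f)) ≡ sum (boolToℕ ∘ p ∘ f)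
length-filterᵇ-tabulate {zero}  p f = refl
length-filterᵇ-tabulate {suc n} p f with p (f zero)
... | true  = cong suc (length-filterᵇ-tabulate p (f ∘ suc))
... | false = length-filterᵇ-tabulate p (f ∘ suc)

count≡sum : ∀ {n} (p : Fin n → Bool) → count p ≡ sum (boolToℕ ∘ p)
count≡sum p = length-filterᵇ-tabulate p (λ i → i)

module _ {n : ℕ} where

  count-suc : ∀ (p : Fin (suc n) → Bool) → count p ≡ boolToℕ (p zero) + count (p ∘ suc)
  count-suc p = trans (count≡sum p) (cong (boolToℕ (p zero) +_) (sym (count≡sum (p ∘ suc))))

  count-cong : ∀ {p q : Fin n → Bool} → (∀ i → p i ≡ q i) → count p ≡ count q
  count-cong {p} {q} p≗q = begin
    count p              ≡⟨ count≡sum p ⟩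
    sum (boolToℕ ∘ p)    ≡⟨ sum-cong-≗ (cong boolToℕ ∘ p≗q) ⟩
    sum (boolToℕ ∘ q)    ≡⟨ count≡sum q ⟨
    count q              ∎
    where open ≡-Reasoning

  count-mono : ∀ {p q : Fin n → Bool} → (∀ i → T (p i) → T (q i)) → count p ≤ count q
  count-mono {p} {q} p⇒q = begin
    count p            ≡⟨ count≡sum p ⟩
    sum (boolToℕ ∘ p)  ≤⟨ sum-mono-≤ (boolToℕ-mono ∘ p⇒q) ⟩
    sum (boolToℕ ∘ q)  ≡⟨ count≡sum q ⟨
    count q            ∎
    where open ≤-Reasoning

  count-cover : ∀ {p q r : Fin n → Bool} → (∀ i → T (p i) → T (q i) ⊎ T (r i)) →
                count p ≤ count q + count r
  count-cover {p} {q} {r} p⇒q∨r = begin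
    count p                                   ≡⟨ count≡sum p ⟩
    sum (boolToℕ ∘ p)                         ≤⟨ sum-mono-≤ (boolToℕ-cover ∘ p⇒q∨r) ⟩
    sum (λ i → boolToℕ (q i) + boolToℕ (r i)) ≡⟨ ∑-distrib-+ (boolToℕ ∘ q) (boolToℕ ∘ r) ⟩
    sum (boolToℕ ∘ q) + sum (boolToℕ ∘ r)     ≡⟨ cong₂ _+_ (count≡sum q) (count≡sum r) ⟨
    count q + count r                         ∎
    where open ≤-Reasoning

  count-split : ∀ (p q : Fin n → Bool) →
                count p ≡ count (λ i → p i ∧ q i) + count (λ i → p i ∧ not (q i))
  count-split p q = begin
    count p               ≡⟨ count≡sum p ⟩
    sum (boolToℕ ∘ p)     ≡⟨ sum-cong-≗ (λ i → boolToℕ-split (p i) (q i)) ⟩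
    sum (λ i → boolToℕ (p i ∧ q i) + boolToℕ (p i ∧ not (q i)))
      ≡⟨ ∑-distrib-+ (λ i → boolToℕ (p i ∧ q i)) (λ i → boolToℕ (p i ∧ not (q i))) ⟩
    sum (λ i → boolToℕ (p i ∧ q i)) + sum (λ i → boolToℕ (p i ∧ not (q i)))
      ≡⟨ cong₂ _+_ (count≡sum (λ i → p i ∧ q i)) (count≡sum (λ i → p i ∧ not (q i))) ⟨
    count (λ i → p i ∧ q i) + count (λ i → p i ∧ not (q i)) ∎
    where open ≡-Reasoning

  count-permute : ∀ (π : Permutation′ n) (p : Fin n → Bool) → count p ≡ count (p ∘ (π ⟨$⟩ʳ_))
  count-permute π p = begin
    count p                           ≡⟨ count≡sum p ⟩
    sum (boolToℕ ∘ p)                 ≡⟨ sum-permute (boolToℕ ∘ p) π ⟩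
    sum (boolToℕ ∘ p ∘ (π ⟨$⟩ʳ_))     ≡⟨ count≡sum (p ∘ (π ⟨$⟩ʳ_)) ⟨
    count (p ∘ (π ⟨$⟩ʳ_))             ∎
    where open ≡-Reasoning

count-witness : ∀ {n} {p : Fin n → Bool} (i : Fin n) → T (p i) → 0 < count p
count-witness {suc n} {p} i pᵢ = begin-strict
  0                                       <⟨ T⇒0<boolToℕ pᵢ ⟩
  boolToℕ (p i)                           ≤⟨ m≤m+n _ _ ⟩
  boolToℕ (p i) + sum (removeAt (boolToℕ ∘ p) i) ≡⟨ sum-remove (boolToℕ ∘ p) ⟨
  sum (boolToℕ ∘ p)                       ≡⟨ count≡sum p ⟨
  count p                                 ∎
  where open ≤-Reasoning

count-none : ∀ {n} {p : Fin n → Bool} → (∀ i → ¬ T (p i)) → count p ≡ 0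
count-none {zero}  _  = refl
count-none {suc n} {p} ¬p = begin
  count p                             ≡⟨ count-suc p ⟩
  boolToℕ (p zero) + count (p ∘ suc)  ≡⟨ cong₂ _+_ (¬T⇒boolToℕ≡0 (¬p zero)) (count-none (¬p ∘ suc)) ⟩
  0                                   ∎
  where open ≡-Reasoning

<?-suc : ∀ {n} (i j : Fin n) → ⌊ suc i <? suc j ⌋ ≡ ⌊ i <? j ⌋
<?-suc i j with i <? j | suc i <? suc j
... | yes _   | yes _     = refl
... | no  _   | no  _     = refl
... | yes i<j | no ¬i+<j+ = contradiction (s<s i<j) ¬i+<j+
... | no ¬i<j | yes i+<j+ = contradiction (s<s⁻¹ i+<j+) ¬i<j

count-< : ∀ {n} (j : Fin n) → count {n} (λ i → ⌊ i <? j ⌋) ≡ toℕ j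
count-< {suc n} zero    = count-none {p = λ (i : Fin (suc n)) → ⌊ i <? zero {n} ⌋} (λ _ ())
count-< {suc n} (suc j) = trans (count-suc (λ (i : Fin (suc n)) → ⌊ i <? suc j ⌋))
                                 (cong suc (trans (count-cong (λ i → <?-suc i j)) (count-< j)))

count-window : ∀ {n} (p : Fin n → Bool) lo m →
               (∀ i → T (p i) → lo ≤ toℕ i × toℕ i < lo + m) → count p ≤ m
count-window {zero}  p lo m inWindow = z≤n
count-window {suc n} p (suc lo) m inWindow = begin
  count p                             ≡⟨ count-suc p ⟩
  boolToℕ (p zero) + count (p ∘ suc)
    ≡⟨ cong (_+ count (p ∘ suc)) (¬T⇒boolToℕ≡0 (n≮0 ∘ proj₁ ∘ inWindow zero)) ⟩
  count (p ∘ suc)                     ≤⟨ count-window (p ∘ suc) lo m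
                                           (λ i pᵢ → Product.map s≤s⁻¹ s≤s⁻¹ (inWindow (suc i) pᵢ)) ⟩
  m                                   ∎
  where open ≤-Reasoning
count-window {suc n} p zero zero inWindow =
  ≤-reflexive (count-none (λ i pᵢ → n≮0 (proj₂ (inWindow i pᵢ))))
count-window {suc n} p zero (suc m) inWindow = begin
  count p                             ≡⟨ count-suc p ⟩
  boolToℕ (p zero) + count (p ∘ suc)  ≤⟨ +-mono-≤ (boolToℕ≤1 (p zero))
                                           (count-window (p ∘ suc) zero m
                                             (λ i pᵢ → z≤n , s<s⁻¹ (proj₂ (inWindow (suc i) pᵢ)))) ⟩
  suc m                               ∎
  where open ≤-Reasoning

module _ {n : ℕ} (π : Permutation′ n) (p : Fin n → Bool) where

  private
    position : Fin n → ℕ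
    position i = toℕ (pos π i)

  count-window-pos : ∀ lo m → (∀ i → T (p i) → lo ≤ position i × position i < lo + m) → count p ≤ m
  count-window-pos lo m inWindow = begin
    count p                 ≡⟨ count-permute π p ⟩
    count (p ∘ (π ⟨$⟩ʳ_))   ≤⟨ count-window (p ∘ (π ⟨$⟩ʳ_)) lo m
                                 (λ j pⱼ → subst (λ x → lo ≤ x × x < lo + m) (cong toℕ (inverseˡ π))
                                                 (inWindow _ pⱼ)) ⟩
    m                       ∎
    where open ≤-Reasoning

  private
    shift : ∀ {x y c m} → c ≤ m → x + c ≤ y + m → x ≤ y + (m ∸ c)
    shift {x} {y} c≤m x+c≤y+m = subst (x ≤_) (+-∸-assoc y c≤m) (m+n≤o⇒m≤o∸n x x+c≤y+m)

    count≤∸⇒count+≤ : ∀ {c m} → c ≤ m → count p ≤ m ∸ c → count p + c ≤ m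
    count≤∸⇒count+≤ {c} c≤m bound = subst (count p + c ≤_) (m∸n+n≡m c≤m) (+-monoˡ-≤ c bound)

  count-window-after : ∀ lo {c m} → c ≤ m →
                       (∀ i → T (p i) → lo < position i × position i + c ≤ lo + m) → count p + c ≤ m
  count-window-after lo {c} {m} c≤m inWindow = count≤∸⇒count+≤ c≤m (count-window-pos (suc lo) (m ∸ c)
    (λ i pᵢ → let lo<i , i+c≤lo+m = inWindow i pᵢ in lo<i , s≤s (shift c≤m i+c≤lo+m)))

  count-window-before : ∀ hi {c m} → c ≤ m →
                        (∀ i → T (p i) → position i < hi × hi + c ≤ position i + m) → count p + c ≤ m
  count-window-before hi {c} {m} c≤m inWindow = count≤∸⇒count+≤ c≤m
    (count-window-pos (hi ∸ (m ∸ c)) (m ∸ c) λ i pᵢ → let i<hi , hi+c≤i+m = inWindow i pᵢ in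
      m≤n+o⇒m∸n≤o hi (m ∸ c) (subst (hi ≤_) (+-comm (position i) (m ∸ c)) (shift c≤m hi+c≤i+m)) ,
      <-≤-trans i<hi (subst (hi ≤_) (+-comm (m ∸ c) (hi ∸ (m ∸ c))) (m≤n+m∸n hi (m ∸ c))))

foldr-⊔-ub : ∀ {A : Set} (f : A → ℕ) {x} (xs : List A) → x ∈ xs → f x ≤ foldr _⊔_ 0 (map f xs)
foldr-⊔-ub f (y ∷ xs) (here refl) = m≤m⊔n _ _
foldr-⊔-ub f (y ∷ xs) (there x∈xs) = ≤-trans (foldr-⊔-ub f xs x∈xs) (m≤n⊔m _ _)

foldr-⊔-lub : ∀ {A : Set} (f : A → ℕ) {m} (xs : List A) → (∀ x → f x ≤ m) → foldr _⊔_ 0 (map f xs) ≤ m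
foldr-⊔-lub f []       f≤m = z≤n
foldr-⊔-lub f (x ∷ xs) f≤m = ⊔-lub (f≤m x) (foldr-⊔-lub f xs f≤m)

module _ {n : ℕ} where

  pos-injective : ∀ (σ : Ordering n) {u w} → pos σ u ≡ pos σ w → u ≡ w
  pos-injective σ {u} {w} eq = begin
    u                    ≡⟨ inverseʳ σ ⟨
    σ ⟨$⟩ʳ (pos σ u)     ≡⟨ cong (σ ⟨$⟩ʳ_) eq ⟩
    σ ⟨$⟩ʳ (pos σ w)     ≡⟨ inverseʳ σ ⟩
    w                    ∎
    where open ≡-Reasoning

  before : Ordering n → Fin n → Fin n → Bool
  before σ u w = ⌊ pos σ u <? pos σ w ⌋

  before-flip : ∀ (σ : Ordering n) {u w} → u ≢ w → not (before σ u w) ≡ before σ w u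
  before-flip σ {u} {w} u≢w with pos σ u <? pos σ w | pos σ w <? pos σ u
  ... | yes u<w | yes w<u = contradiction w<u (<-asym u<w)
  ... | yes _   | no  _   = refl
  ... | no  _   | yes _   = refl
  ... | no  u≮w | no  w≮u =
    contradiction (pos-injective σ (toℕ-injective (≤-antisym (≮⇒≥ w≮u) (≮⇒≥ u≮w)))) u≢w

  before⇒< : ∀ (σ : Ordering n) {u w} → T (before σ u w) → toℕ (pos σ u) < toℕ (pos σ w)
  before⇒< σ = toWitness

  before⇒≢ : ∀ (σ : Ordering n) {u w} → T (before σ u w) → u ≢ w
  before⇒≢ σ u<w refl = <-irrefl refl (before⇒< σ u<w)

  count-before≡pos : ∀ (σ : Ordering n) v → count (λ w → before σ w v) ≡ toℕ (pos σ v)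
  count-before≡pos σ v = begin
    count (λ w → before σ w v)               ≡⟨ count-permute σ (λ w → before σ w v) ⟩
    count (λ i → before σ (σ ⟨$⟩ʳ i) v)
      ≡⟨ count-cong {p = λ i → before σ (σ ⟨$⟩ʳ i) v} (λ i → cong (λ j → ⌊ j <? pos σ v ⌋) (inverseˡ σ)) ⟩
    count {n} (λ i → ⌊ i <? pos σ v ⌋)       ≡⟨ count-< (pos σ v) ⟩
    toℕ (pos σ v)                            ∎
    where open ≡-Reasoning

T-∧⁻ : ∀ a {b} → T (a ∧ b) → T a × T b
T-∧⁻ a = Equivalence.to (T-∧ {a})

∧-cong-T : ∀ a {b c} → (T a → b ≡ c) → a ∧ b ≡ a ∧ c
∧-cong-T true  b≡c = b≡c _
∧-cong-T false _   = refl

∨-cover : ∀ a b c d → T (a ∨ b) → T (c ∨ d) ⊎ T ((a ∧ not c) ∨ (b ∧ not d))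
∨-cover _     _     true  _     _ = inj₁ _
∨-cover _     _     false true  _ = inj₁ _
∨-cover true  _     false false _ = inj₂ _
∨-cover false true  false false _ = inj₂ _

+-offsets-cancel : ∀ x y a b k → x + b ≤ a + k → y + a ≤ b + k → x + y ≤ k + k
+-offsets-cancel x y a b k x+b≤a+k y+a≤b+k = +-cancelʳ-≤ (a + b) (x + y) (k + k) (begin
  x + y + (a + b)      ≡⟨ solve (x ∷ y ∷ a ∷ b ∷ []) ⟩
  (x + b) + (y + a)    ≤⟨ +-mono-≤ x+b≤a+k y+a≤b+k ⟩
  (a + k) + (b + k)    ≡⟨ solve (a ∷ b ∷ k ∷ []) ⟩
  k + k + (a + b)      ∎)
  where open ≤-Reasoning

module _ {n : ℕ} (G : Tournament n) where

  arc⇒≢ : ∀ {u w} → T (arc G u w) → u ≢ w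
  arc⇒≢ {u} uu refl = subst T (irrefl G u) uu

  not-arc : ∀ {u w} → u ≢ w → not (arc G u w) ≡ arc G w u
  not-arc {u} {w} u≢w = trans (cong not (tourn G u w u≢w)) (not-involutive (arc G w u))

  inBackward outBackward : Ordering n → Fin n → ℕ
  inBackward  σ v = count (λ w → backward G σ w v)
  outBackward σ v = count (λ w → backward G σ v w)

  inDeg+outBackward≡pos+inBackward : ∀ σ v →
    inDeg G v + outBackward σ v ≡ toℕ (pos σ v) + inBackward σ v
  inDeg+outBackward≡pos+inBackward σ v = begin
    inDeg G v + outBackward σ v                    ≡⟨ cong (_+ outBackward σ v) inDeg≡ ⟩
    inPreceding + inBackward σ v + outBackward σ v ≡⟨ xy∙z≈xz∙y inPreceding _ _ ⟩
    inPreceding + outBackward σ v + inBackward σ v ≡⟨ cong (_+ inBackward σ v) pos≡ ⟨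
    toℕ (pos σ v) + inBackward σ v                 ∎
    where
    open ≡-Reasoning
    inPreceding : ℕ
    inPreceding = count (λ w → arc G w v ∧ before σ w v)

    inDeg≡ : inDeg G v ≡ inPreceding + inBackward σ v
    inDeg≡ = trans (count-split (λ w → arc G w v) (λ w → before σ w v))
      (cong (inPreceding +_) (count-cong (λ w → ∧-cong-T (arc G w v) (before-flip σ ∘ arc⇒≢))))

    pos≡ : toℕ (pos σ v) ≡ inPreceding + outBackward σ v
    pos≡ = begin
      toℕ (pos σ v)                ≡⟨ count-before≡pos σ v ⟨
      count (λ w → before σ w v)   ≡⟨ count-split (λ w → before σ w v) (λ w → arc G w v) ⟩
      count (λ w → before σ w v ∧ arc G w v) + count (λ w → before σ w v ∧ not (arc G w v))
        ≡⟨ cong₂ _+_ (count-cong (λ w → ∧-comm (before σ w v) (arc G w v)))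
                     (count-cong (λ w → trans (∧-cong-T (before σ w v) (not-arc ∘ before⇒≢ σ))
                                              (∧-comm (before σ w v) (arc G v w)))) ⟩
      inPreceding + outBackward σ v ∎

  incident : Ordering n → Fin n → Fin n → Bool
  incident σ v w = backward G σ v w ∨ backward G σ w v

  dσ≤Δσ : ∀ σ v → dσ G σ v ≤ Δσ G σ
  dσ≤Δσ σ v = foldr-⊔-ub (dσ G σ) (allFin n) (∈-allFin v)

  Δσ-lub : ∀ σ {m} → (∀ v → dσ G σ v ≤ m) → Δσ G σ ≤ m
  Δσ-lub σ = foldr-⊔-lub (dσ G σ) (allFin n)

  inBackward≤Δσ : ∀ σ v → inBackward σ v ≤ Δσ G σ
  inBackward≤Δσ σ v = ≤-trans
    (count-mono {p = λ w → backward G σ w v} {q = incident σ v} (λ w → Equivalence.from T-∨ ∘ inj₂))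
    (dσ≤Δσ σ v)

  outBackward≤Δσ : ∀ σ v → outBackward σ v ≤ Δσ G σ
  outBackward≤Δσ σ v = ≤-trans
    (count-mono {p = λ w → backward G σ v w} {q = incident σ v} (λ w → Equivalence.from T-∨ ∘ inj₁))
    (dσ≤Δσ σ v)

  pos≤inDeg+Δσ : ∀ σ v → toℕ (pos σ v) ≤ inDeg G v + Δσ G σ
  pos≤inDeg+Δσ σ v = begin
    toℕ (pos σ v)                   ≤⟨ m≤m+n _ _ ⟩
    toℕ (pos σ v) + inBackward σ v  ≡⟨ inDeg+outBackward≡pos+inBackward σ v ⟨
    inDeg G v + outBackward σ v     ≤⟨ +-monoʳ-≤ (inDeg G v) (outBackward≤Δσ σ v) ⟩
    inDeg G v + Δσ G σ              ∎
    where open ≤-Reasoning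

  inDeg≤pos+Δσ : ∀ σ v → inDeg G v ≤ toℕ (pos σ v) + Δσ G σ
  inDeg≤pos+Δσ σ v = begin
    inDeg G v                       ≤⟨ m≤m+n _ _ ⟩
    inDeg G v + outBackward σ v     ≡⟨ inDeg+outBackward≡pos+inBackward σ v ⟩
    toℕ (pos σ v) + inBackward σ v  ≤⟨ +-monoʳ-≤ (toℕ (pos σ v)) (inBackward≤Δσ σ v) ⟩
    toℕ (pos σ v) + Δσ G σ          ∎
    where open ≤-Reasoning

  sorted⇒inDeg-mono : ∀ σ → InDegreeSorted G σ → ∀ {u w} → T (before σ u w) → inDeg G u ≤ inDeg G w
  sorted⇒inDeg-mono σ sorted u<w = subst₂ (λ x y → inDeg G x ≤ inDeg G y) (inverseʳ σ) (inverseʳ σ)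
    (sorted (pos σ _) (pos σ _) (<⇒≤ (before⇒< σ u<w)))

  extraBackwardOut extraBackwardIn : Ordering n → Ordering n → Fin n → Fin n → Bool
  extraBackwardOut σ s v w = backward G σ v w ∧ not (backward G s v w)
  extraBackwardIn  σ s v w = extraBackwardOut σ s w v

  extraBackward⇒orders : ∀ σ s {u w} → T (extraBackwardOut σ s u w) → T (before σ w u) × T (before s u w)
  extraBackward⇒orders σ s {u} {w} extra = w<u , subst T (before-flip s (arc⇒≢ uw ∘ sym)) ¬w<u
    where
    backwardσ = T-∧⁻ (backward G σ u w) extra .proj₁
    uw  = T-∧⁻ (arc G u w) backwardσ .proj₁
    w<u = T-∧⁻ (arc G u w) backwardσ .proj₂
    ¬w<u : T (not (before s w u))
    ¬w<u = subst (λ a → T (not (a ∧ before s w u))) (Equivalence.to T-≡ uw)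
                 (T-∧⁻ (backward G σ u w) extra .proj₂)

  module _ (σ : Ordering n) (sorted : InDegreeSorted G σ) (s : Ordering n) (v : Fin n) where

    private
      P : Fin n → ℕ
      P w = toℕ (pos s w)
      k = Δσ G s

    count-extraBackwardOut : count (extraBackwardOut σ s v) + outBackward s v ≤ inBackward s v + k
    count-extraBackwardOut = count-window-after s (extraBackwardOut σ s v) (P v)
      (≤-trans (outBackward≤Δσ s v) (m≤n+m k _)) window
      where
      window : ∀ w → T (extraBackwardOut σ s v w) →
               P v < P w × P w + outBackward s v ≤ P v + (inBackward s v + k)
      window w extra = before⇒< s v<ₛw , (begin
          P w + outBackward s v                ≤⟨ +-monoˡ-≤ _ (pos≤inDeg+Δσ s w) ⟩
          inDeg G w + k + outBackward s v      ≤⟨ +-monoˡ-≤ _ (+-monoˡ-≤ k (sorted⇒inDeg-mono σ sorted w<v)) ⟩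
          inDeg G v + k + outBackward s v      ≡⟨ xy∙z≈xz∙y (inDeg G v) k _ ⟩
          inDeg G v + outBackward s v + k      ≡⟨ cong (_+ k) (inDeg+outBackward≡pos+inBackward s v) ⟩
          P v + inBackward s v + k             ≡⟨ +-assoc (P v) _ k ⟩
          P v + (inBackward s v + k)           ∎)
        where
        open ≤-Reasoning
        w<v = extraBackward⇒orders σ s extra .proj₁
        v<ₛw = extraBackward⇒orders σ s extra .proj₂

    count-extraBackwardIn : count (extraBackwardIn σ s v) + inBackward s v ≤ outBackward s v + k
    count-extraBackwardIn = count-window-before s (extraBackwardIn σ s v) (P v)
      (≤-trans (inBackward≤Δσ s v) (m≤n+m k _)) window
      where
      window : ∀ w → T (extraBackwardIn σ s v w) →
               P w < P v × P v + inBackward s v ≤ P w + (outBackward s v + k)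
      window w extra = before⇒< s w<ₛv , (begin
          P v + inBackward s v                 ≡⟨ inDeg+outBackward≡pos+inBackward s v ⟨
          inDeg G v + outBackward s v          ≤⟨ +-monoˡ-≤ _ (sorted⇒inDeg-mono σ sorted v<w) ⟩
          inDeg G w + outBackward s v          ≤⟨ +-monoˡ-≤ _ (inDeg≤pos+Δσ s w) ⟩
          P w + k + outBackward s v            ≡⟨ +-assoc (P w) k _ ⟩
          P w + (k + outBackward s v)          ≡⟨ cong (P w +_) (+-comm k _) ⟩
          P w + (outBackward s v + k)          ∎)
        where
        open ≤-Reasoning
        v<w = extraBackward⇒orders σ s extra .proj₁
        w<ₛv = extraBackward⇒orders σ s extra .proj₂

    dσ-sorted≤3*Δσ : dσ G σ v ≤ 3 * k
    dσ-sorted≤3*Δσ = begin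
      dσ G σ v
        ≤⟨ count-cover {p = incident σ v} {q = incident s v} {r = extraBackward}
             (λ w → ∨-cover (backward G σ v w) (backward G σ w v) (backward G s v w) (backward G s w v)) ⟩
      dσ G s v + count extraBackward
        ≤⟨ +-mono-≤ (dσ≤Δσ s v) (count-cover {p = extraBackward} (λ w → Equivalence.to T-∨)) ⟩
      k + (count (extraBackwardOut σ s v) + count (extraBackwardIn σ s v))
        ≤⟨ +-monoʳ-≤ k (+-offsets-cancel (count (extraBackwardOut σ s v)) (count (extraBackwardIn σ s v))
                          (inBackward s v) (outBackward s v) k count-extraBackwardOut count-extraBackwardIn) ⟩
      k + (k + k)
        ≡⟨ cong (λ x → k + (k + x)) (+-identityʳ k) ⟨
      3 * k ∎
      where
      open ≤-Reasoning
      extraBackward : Fin n → Bool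
      extraBackward w = extraBackwardOut σ s v w ∨ extraBackwardIn σ s v w

  Δσ-sorted≤3*Δσ : ∀ σ → InDegreeSorted G σ → ∀ s → Δσ G σ ≤ 3 * Δσ G s
  Δσ-sorted≤3*Δσ σ sorted s = Δσ-lub σ (dσ-sorted≤3*Δσ σ sorted s)

  arc-backward⇒1≤Δσ : ∀ σ {u w} → T (arc G u w) → toℕ (pos σ w) < toℕ (pos σ u) → 1 ≤ Δσ G σ
  arc-backward⇒1≤Δσ σ {u} {w} uw w<u = ≤-trans (count-witness {p = incident σ u} w uw-incident) (dσ≤Δσ σ u)
    where
    uw-incident : T (incident σ u w)
    uw-incident = Equivalence.from T-∨ (inj₁ (Equivalence.from T-∧ (uw , fromWitness w<u)))

  triangle⇒1≤Δσ : ∀ {u v w} → T (arc G u v) → T (arc G v w) → T (arc G w u) → ∀ σ → 1 ≤ Δσ G σ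
  triangle⇒1≤Δσ {u} {v} {w} uv vw wu σ with pos σ v <? pos σ u | pos σ w <? pos σ v | pos σ u <? pos σ w
  ... | yes v<u | _       | _       = arc-backward⇒1≤Δσ σ uv v<u
  ... | no _    | yes w<v | _       = arc-backward⇒1≤Δσ σ vw w<v
  ... | no _    | no _    | yes u<w = arc-backward⇒1≤Δσ σ wu u<w
  ... | no v≮u  | no w≮v  | no u≮w  = contradiction
    (pos-injective σ (toℕ-injective (≤-antisym (≮⇒≥ v≮u) (≤-trans (≮⇒≥ w≮v) (≮⇒≥ u≮w))))) (arc⇒≢ uv)

exArc : Fin 5 → Fin 5 → Bool
exArc 3F 0F = true
exArc 0F 3F = false
exArc 4F 1F = true
exArc 1F 4F = false
exArc u  v  = ⌊ u <? v ⌋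

exT : Tournament 5
exT = record
  { arc    = exArc
  ; irrefl = toWitness {a? = all? λ v → exArc v v ≟ᵇ false} _
  ; tourn  = toWitness {a? = all? λ u → all? λ v → ¬? (u ≟ v) →-dec (exArc u v ≟ᵇ not (exArc v u))} _
  }

-- lists the vertices in the order 0, 3, 1, 2, 4
exσ : Ordering 5
exσ = transpose 1F 2F ∘ₚ transpose 2F 3F

exσ-sorted : InDegreeSorted exT exσ
exσ-sorted = toWitness {a? = all? λ i → all? λ j →
  (i ≤ᶠ? j) →-dec (inDeg exT (exσ ⟨$⟩ʳ i) ≤? inDeg exT (exσ ⟨$⟩ʳ j))} _

mainTheorem4 :
    (∀ (n : ℕ) (T : Tournament n) (σ : Ordering n) (k : ℕ) →
       InDegreeSorted T σ → IsDegreewidth T k → Δσ T σ ≤ 3 * k)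
    ×
    Σ ℕ (λ n → Σ (Tournament n) (λ T → Σ (Ordering n) (λ σ → Σ ℕ (λ k →
       InDegreeSorted T σ × IsDegreewidth T k × Δσ T σ ≡ 3 * k × 0 < k))))
mainTheorem4 = sorted≤3*degreewidth , (5 , exT , exσ , 1 , exσ-sorted , degreewidth≡1 , refl , s≤s z≤n)
  where
  sorted≤3*degreewidth : ∀ n (G : Tournament n) σ k →
                         InDegreeSorted G σ → IsDegreewidth G k → Δσ G σ ≤ 3 * k
  sorted≤3*degreewidth n G σ k sorted ((s , Δs≡k) , _) =
    subst (λ x → Δσ G σ ≤ 3 * x) Δs≡k (Δσ-sorted≤3*Δσ G σ sorted s)

  degreewidth≡1 : IsDegreewidth exT 1
  degreewidth≡1 = (idₚ , refl) , triangle⇒1≤Δσ exT {0F} {1F} {3F} _ _ _
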